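{- Letting each elementary transposition $s_i=(i,i+1)$ act on $m\in\mathrm{BW}$ by swapping the $i$-th and $(i+1)$-st columns of $m$ if one of these two columns is empty, and fixing $m$ otherwise, defines an action of $\mathfrak{S}_\infty$ on $\mathrm{BW}$.
   Context: A word $u=u_1\dots u_n$ on positive integers is a prime parking function if its nondecreasing rearrangement $u'$ satisfies $u'_1\le1$ and $u'_i<i$ for $2\le i\le n$ (the empty word is one). $\mathrm{BW}$ is the set of infinite sequences of columns $(L_1,M_1),(L_2,M_2),\dots$, $L_i$ a finite set of positive integers and $M_i$ a word, such that the nonempty $L_i$, in order, form a set composition of $[n]$ for some $n$, and each $M_i$ is a prime parking function of length $|L_i|$. A column is empty if $L_i=\emptyset$ (and $M_i$ is the empty word). $\mathfrak{S}_\infty$ is the infinite symmetric group generated by $s_i=(i,i+1)$, $i\ge1$. -}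

module Defs where

open import Data.Nat using (ℕ; zero; suc; _≤_; _<_; _⊔_; _≡ᵇ_)
open import Data.Nat.Properties using (≤-decTotalOrder)
open import Data.Bool using (Bool; true; false; if_then_else_; _∨_)
open import Data.List using (List; []; _∷_; length; lookup; null)
open import Data.List.Membership.Propositional using (_∈_)
open import Data.List.Relation.Unary.All using (All)
open import Data.List.Relation.Unary.Linked using (Linked)
open import Data.List.Sort ≤-decTotalOrder using (sort)
open import Data.Fin using (Fin; toℕ)
open import Data.Product using (Σ; ∃; _×_)
open import Relation.Binary.PropositionalEquality using (_≡_)

-- A finite set of positive integers, represented canonically as a
-- strictly increasing list.
FinSet : Set
FinSet = List ℕ

Column : Set
Column = List ℕ × List ℕ

open Data.Product using (_,_; proj₁; proj₂) public

-- An infinite sequence of columns; position 0 holds the paper's column 1,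
-- position k holds column k+1.
Seq : Set
Seq = ℕ → Column

rearr : List ℕ → List ℕ
rearr = sort

-- Prime parking function: a word on positive integers whose nondecreasing
-- rearrangement u' satisfies u'_1 ≤ 1 and u'_i < i for i ≥ 2
-- (0-based position p: u'_p ≤ 1 if p = 0, u'_p ≤ p if p ≥ 1, i.e. u'_p ≤ p ⊔ 1).
IsPrimePF : List ℕ → Set
IsPrimePF u =
  All (λ x → 1 ≤ x) u ×
  ((p : Fin (length (rearr u))) → lookup (rearr u) p ≤ toℕ p ⊔ 1)

-- The nonempty L_i (in order) form a set composition of [n], each L_i is a
-- finite set (strictly increasing list), and M_i is a prime parking function
-- of length |L_i|.
IsBW : Seq → Set
IsBW m =
  ((i : ℕ) → Linked _<_ (proj₁ (m i))) ×
  ((i : ℕ) → IsPrimePF (proj₂ (m i)) × length (proj₂ (m i)) ≡ length (proj₁ (m i))) ×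
  (Σ ℕ λ n →
     ((i k : ℕ) → k ∈ proj₁ (m i) → 1 ≤ k × k ≤ n) ×
     ((k : ℕ) → 1 ≤ k → k ≤ n → ∃ λ i → k ∈ proj₁ (m i)) ×
     ((i j k : ℕ) → k ∈ proj₁ (m i) → k ∈ proj₁ (m j) → i ≡ j))

emptyCol : Column → Bool
emptyCol c = null (proj₁ c)

-- The transposition of positions i and i+1 (0-based), i.e. the paper's
-- s_{i+1} = (i+1, i+2) acting on 1-based positions.
swap : ℕ → ℕ → ℕ
swap i k = if k ≡ᵇ i then suc i else (if k ≡ᵇ suc i then i else k)

sAct : ℕ → Seq → Seq
sAct i m = if emptyCol (m i) ∨ emptyCol (m (suc i)) then (λ k → m (swap i k)) else m

-- Words in the generators; the permutation of ℕ a word represents, and the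
-- induced map on sequences (both left actions: the head letter acts last).
perm : List ℕ → ℕ → ℕ
perm [] k = k
perm (i ∷ w) k = swap i (perm w k)

act : List ℕ → Seq → Seq
act [] m = m
act (i ∷ w) m = sAct i (act w m)

-- A generator either fixes m or permutes its columns by a transposition, so it
-- preserves BW. For the relations: s_i only ever exchanges a nonempty column
-- with an empty one, so a word w moves the empty columns exactly as the
-- permutation it represents does, and never changes the relative order of the
-- nonempty columns. Hence the positions of the empty columns of w·m depend only
-- on perm w, the nonempty columns of w·m are those of m in their original
-- order, and empty columns of a BW element are all ([] , []).
module Submission where

open import Defs
open import Data.Bool using (Bool; true; false; if_then_else_)
open import Data.Bool.Properties using (¬-not; T-≡)
open import Data.List using (List; []; _∷_)
open import Data.List.Membership.Propositional using (_∈_)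
open import Data.Nat using (ℕ; zero; suc; _+_; _≤_; _<_; z≤n; s≤s; _≡ᵇ_)
open import Data.Nat.Properties
open import Algebra.Properties.CommutativeSemigroup +-commutativeSemigroup
  using (x∙yz≈y∙xz)
open import Data.Product using (_×_; Σ; _,_)
open import Data.Sum using (_⊎_; inj₁; inj₂)
open import Function using (_∘_; Equivalence)
open import Relation.Binary using (tri<; tri≈; tri>)
open import Relation.Binary.PropositionalEquality hiding ([_])
open import Relation.Nullary using (yes; no; contradiction)

≡ᵇ-refl : ∀ n → (n ≡ᵇ n) ≡ true
≡ᵇ-refl n = Equivalence.to T-≡ (≡⇒≡ᵇ n n refl)

≢⇒≡ᵇ-false : ∀ m n → m ≢ n → (m ≡ᵇ n) ≡ false
≢⇒≡ᵇ-false m n m≢n = ¬-not (m≢n ∘ ≡ᵇ⇒≡ m n ∘ Equivalence.from T-≡)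

n≢1+n : ∀ {n} → n ≢ suc n
n≢1+n = 1+n≢n ∘ sym

swap-at-i : ∀ i → swap i i ≡ suc i
swap-at-i i rewrite ≡ᵇ-refl i = refl

swap-at-suc-i : ∀ i → swap i (suc i) ≡ i
swap-at-suc-i i rewrite ≢⇒≡ᵇ-false (suc i) i 1+n≢n | ≡ᵇ-refl i = refl

swap-fixes : ∀ i j → j ≢ i → j ≢ suc i → swap i j ≡ j
swap-fixes i j j≢i j≢1+i rewrite ≢⇒≡ᵇ-false j i j≢i | ≢⇒≡ᵇ-false j (suc i) j≢1+i = refl

swap-involutive : ∀ i j → swap i (swap i j) ≡ j
swap-involutive i j with j ≟ i | j ≟ suc i
... | yes refl | _        rewrite swap-at-i j = swap-at-suc-i j
... | no _     | yes refl rewrite swap-at-suc-i i = swap-at-i i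
... | no j≢i   | no j≢1+i rewrite swap-fixes i j j≢i j≢1+i = swap-fixes i j j≢i j≢1+i

∘swap-≗ : ∀ {A : Set} (e : ℕ → A) i → e i ≡ e (suc i) → e ∘ swap i ≗ e
∘swap-≗ e i eᵢ≡eᵢ₊₁ j with j ≟ i | j ≟ suc i
... | yes refl | _        rewrite swap-at-i j = sym eᵢ≡eᵢ₊₁
... | no _     | yes refl rewrite swap-at-suc-i i = eᵢ≡eᵢ₊₁
... | no j≢i   | no j≢1+i = cong e (swap-fixes i j j≢i j≢1+i)

IsBW-reindex : ∀ (f g : ℕ → ℕ) → f ∘ g ≗ (λ k → k) → g ∘ f ≗ (λ k → k) →
               ∀ m → IsBW m → IsBW (m ∘ f)
IsBW-reindex f g f∘g g∘f m (sets , words , n , bounded , covering , disjoint) =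
  sets ∘ f , words ∘ f , n , bounded ∘ f ,
  (λ k 1≤k k≤n → let i , k∈mᵢ = covering k 1≤k k≤n in
     g i , subst (λ z → k ∈ proj₁ (m z)) (sym (f∘g i)) k∈mᵢ) ,
  (λ i j k k∈i k∈j →
     trans (sym (g∘f i)) (trans (cong g (disjoint (f i) (f j) k k∈i k∈j)) (g∘f j)))

IsBW-∘swap : ∀ i m → IsBW m → IsBW (m ∘ swap i)
IsBW-∘swap i = IsBW-reindex (swap i) (swap i) (swap-involutive i) (swap-involutive i)

IsBW-sAct : ∀ i m → IsBW m → IsBW (sAct i m)
IsBW-sAct i m bw with emptyCol (m i) | emptyCol (m (suc i))
... | true  | _     = IsBW-∘swap i m bw
... | false | true  = IsBW-∘swap i m bw
... | false | false = bw

IsBW-act : ∀ w m → IsBW m → IsBW (act w m)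
IsBW-act []      m bw = bw
IsBW-act (i ∷ w) m bw = IsBW-sAct i (act w m) (IsBW-act w m bw)

EmptyColumnsBlank : Seq → Set
EmptyColumnsBlank a = ∀ j → emptyCol (a j) ≡ true → a j ≡ ([] , [])

IsBW⇒EmptyColumnsBlank : ∀ m → IsBW m → EmptyColumnsBlank m
IsBW⇒EmptyColumnsBlank m (_ , words , _) j with m j | proj₂ (words j)
... | [] , [] | _  = λ _ → refl
... | [] , _ ∷ _ | ()
... | _ ∷ _ , _ | _ = λ ()

emptyCol-sAct : ∀ i a j → emptyCol (sAct i a j) ≡ emptyCol (a (swap i j))
emptyCol-sAct i a j with emptyCol (a i) in eᵢ | emptyCol (a (suc i)) in eᵢ₊₁
... | true  | _     = refl
... | false | true  = refl
... | false | false = sym (∘swap-≗ (emptyCol ∘ a) i (trans eᵢ (sym eᵢ₊₁)) j)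

permInv : List ℕ → ℕ → ℕ
permInv []      j = j
permInv (i ∷ w) j = permInv w (swap i j)

perm-permInv : ∀ w j → perm w (permInv w j) ≡ j
perm-permInv []      j = refl
perm-permInv (i ∷ w) j = trans (cong (swap i) (perm-permInv w (swap i j))) (swap-involutive i j)

permInv-perm : ∀ w k → permInv w (perm w k) ≡ k
permInv-perm []      k = refl
permInv-perm (i ∷ w) k = trans (cong (permInv w) (swap-involutive i (perm w k))) (permInv-perm w k)

perm-≗⇒permInv-≗ : ∀ w w′ → perm w ≗ perm w′ → permInv w ≗ permInv w′
perm-≗⇒permInv-≗ w w′ perm≗ j = begin
  permInv w j                           ≡⟨ cong (permInv w) (sym (perm-permInv w′ j)) ⟩
  permInv w (perm w′ (permInv w′ j))    ≡⟨ cong (permInv w) (sym (perm≗ (permInv w′ j))) ⟩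
  permInv w (perm w (permInv w′ j))     ≡⟨ permInv-perm w (permInv w′ j) ⟩
  permInv w′ j                          ∎
  where open ≡-Reasoning

emptyCol-act : ∀ w m j → emptyCol (act w m j) ≡ emptyCol (m (permInv w j))
emptyCol-act []      m j = refl
emptyCol-act (i ∷ w) m j = trans (emptyCol-sAct i (act w m) j) (emptyCol-act w m (swap i j))

falseIndicator : Bool → ℕ
falseIndicator b = if b then 0 else 1

falseCount : (ℕ → Bool) → ℕ → ℕ
falseCount e zero    = 0
falseCount e (suc n) = falseIndicator (e n) + falseCount e n

falseCount-cong : ∀ {e e′} → e ≗ e′ → falseCount e ≗ falseCount e′
falseCount-cong e≗e′ zero    = refl
falseCount-cong e≗e′ (suc n) = cong₂ _+_ (cong falseIndicator (e≗e′ n)) (falseCount-cong e≗e′ n)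

falseCount-mono : ∀ e {p q} → p ≤ q → falseCount e p ≤ falseCount e q
falseCount-mono e {q = zero} z≤n = ≤-refl
falseCount-mono e {q = suc q} p≤1+q with m≤n⇒m<n∨m≡n p≤1+q
... | inj₂ refl       = ≤-refl
... | inj₁ (s≤s p≤q) = ≤-trans (falseCount-mono e p≤q) (m≤n+m _ _)

falseCount-< : ∀ e {p q} → e p ≡ false → p < q → falseCount e p < falseCount e q
falseCount-< e {p} {q} eₚ p<q =
  subst (_≤ falseCount e q) (cong (λ b → falseIndicator b + falseCount e p) eₚ)
        (falseCount-mono e p<q)

falseCount-injective : ∀ e {p p′} → e p ≡ false → e p′ ≡ false →
                       falseCount e p ≡ falseCount e p′ → p ≡ p′
falseCount-injective e {p} {p′} eₚ eₚ′ same with <-cmp p p′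
... | tri< p<p′ _ _ = contradiction same (<⇒≢ (falseCount-< e eₚ p<p′))
... | tri≈ _ p≡p′ _ = p≡p′
... | tri> _ _ p′<p = contradiction (sym same) (<⇒≢ (falseCount-< e eₚ′ p′<p))

falseCount-swap : ∀ e i j → j ≢ suc i → falseCount (e ∘ swap i) j ≡ falseCount e j
falseCount-swap e i zero    _          = refl
falseCount-swap e i (suc j) 1+j≢2+i with j ≟ i | j ≟ suc i
... | yes refl | _        = contradiction refl 1+j≢2+i
... | no _     | yes refl = begin
  [ e (swap i (suc i)) ] + ([ e (swap i i) ] + falseCount (e ∘ swap i) i)
    ≡⟨ cong₂ (λ x y → [ e x ] + ([ e y ] + falseCount (e ∘ swap i) i)) (swap-at-suc-i i) (swap-at-i i) ⟩
  [ e i ] + ([ e (suc i) ] + falseCount (e ∘ swap i) i)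
    ≡⟨ cong (λ c → [ e i ] + ([ e (suc i) ] + c)) (falseCount-swap e i i n≢1+n) ⟩
  [ e i ] + ([ e (suc i) ] + falseCount e i)
    ≡⟨ x∙yz≈y∙xz [ e i ] [ e (suc i) ] (falseCount e i) ⟩
  [ e (suc i) ] + ([ e i ] + falseCount e i)
    ∎
  where
  open ≡-Reasoning
  [_] = falseIndicator
... | no j≢i   | no j≢1+i =
  cong₂ _+_ (cong (falseIndicator ∘ e) (swap-fixes i j j≢i j≢1+i)) (falseCount-swap e i j j≢1+i)

falseCount-∘swap : ∀ e i j → e i ≡ true ⊎ e (suc i) ≡ true → e (swap i j) ≡ false →
                   falseCount (e ∘ swap i) j ≡ falseCount e (swap i j)
falseCount-∘swap e i j one-true e∘swapⱼ with j ≟ i | j ≟ suc i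
... | yes refl | _ with one-true
...   | inj₁ eᵢ   rewrite swap-at-i j | eᵢ = falseCount-swap e j j n≢1+n
...   | inj₂ eᵢ₊₁ rewrite swap-at-i j = contradiction (trans (sym eᵢ₊₁) e∘swapⱼ) λ ()
falseCount-∘swap e i j one-true e∘swapⱼ | no _ | yes refl with one-true
...   | inj₁ eᵢ   rewrite swap-at-suc-i i = contradiction (trans (sym eᵢ) e∘swapⱼ) λ ()
...   | inj₂ eᵢ₊₁ rewrite swap-at-suc-i i | swap-at-i i | eᵢ₊₁ = falseCount-swap e i i n≢1+n
falseCount-∘swap e i j _ _ | no j≢i | no j≢1+i rewrite swap-fixes i j j≢i j≢1+i =
  falseCount-swap e i j j≢1+i

rank : Seq → ℕ → ℕ
rank a = falseCount (emptyCol ∘ a)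

NonemptyByRank : Seq → Seq → Set
NonemptyByRank m a = ∀ j → emptyCol (a j) ≡ false →
                     Σ ℕ λ p → rank m p ≡ rank a j × a j ≡ m p

NonemptyByRank-swap : ∀ m a i → emptyCol (a i) ≡ true ⊎ emptyCol (a (suc i)) ≡ true →
                      NonemptyByRank m a → NonemptyByRank m (a ∘ swap i)
NonemptyByRank-swap m a i one-empty byRank j nonempty =
  let p , rankₚ , aⱼ≡mₚ = byRank (swap i j) nonempty in
  p , trans rankₚ (sym (falseCount-∘swap (emptyCol ∘ a) i j one-empty nonempty)) , aⱼ≡mₚ

NonemptyByRank-sAct : ∀ m a i → NonemptyByRank m a → NonemptyByRank m (sAct i a)
NonemptyByRank-sAct m a i with emptyCol (a i) in eᵢ | emptyCol (a (suc i)) in eᵢ₊₁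
... | true  | _     = NonemptyByRank-swap m a i (inj₁ eᵢ)
... | false | true  = NonemptyByRank-swap m a i (inj₂ eᵢ₊₁)
... | false | false = λ byRank → byRank

NonemptyByRank-act : ∀ w m → NonemptyByRank m (act w m)
NonemptyByRank-act []      m j _ = j , refl , refl
NonemptyByRank-act (i ∷ w) m = NonemptyByRank-sAct m (act w m) i (NonemptyByRank-act w m)

NonemptyByRank-unique : ∀ m a b → EmptyColumnsBlank a → EmptyColumnsBlank b →
                        emptyCol ∘ a ≗ emptyCol ∘ b →
                        NonemptyByRank m a → NonemptyByRank m b → a ≗ b
NonemptyByRank-unique m a b blankᵃ blankᵇ sameEmpty byRankᵃ byRankᵇ j with emptyCol (a j) in eᵃ
... | true  = trans (blankᵃ j eᵃ) (sym (blankᵇ j eᵇ))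
  where eᵇ = trans (sym (sameEmpty j)) eᵃ
... | false with byRankᵃ j eᵃ | byRankᵇ j (trans (sym (sameEmpty j)) eᵃ)
...   | p , rankₚ , aⱼ≡mₚ | p′ , rankₚ′ , bⱼ≡mₚ′ = trans aⱼ≡mₚ (trans (cong m p≡p′) (sym bⱼ≡mₚ′))
  where
  p≡p′ : p ≡ p′
  p≡p′ = falseCount-injective (emptyCol ∘ m)
           (trans (cong emptyCol (sym aⱼ≡mₚ)) eᵃ)
           (trans (cong emptyCol (sym bⱼ≡mₚ′)) (trans (sym (sameEmpty j)) eᵃ))
           (trans rankₚ (trans (falseCount-cong sameEmpty j) (sym rankₚ′)))

act-perm-invariant : ∀ w w′ → perm w ≗ perm w′ → ∀ m → IsBW m → act w m ≗ act w′ m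
act-perm-invariant w w′ perm≗ m bw =
  NonemptyByRank-unique m (act w m) (act w′ m)
    (IsBW⇒EmptyColumnsBlank (act w m) (IsBW-act w m bw))
    (IsBW⇒EmptyColumnsBlank (act w′ m) (IsBW-act w′ m bw))
    sameEmpty (NonemptyByRank-act w m) (NonemptyByRank-act w′ m)
  where
  sameEmpty : emptyCol ∘ act w m ≗ emptyCol ∘ act w′ m
  sameEmpty j = begin
    emptyCol (act w m j)         ≡⟨ emptyCol-act w m j ⟩
    emptyCol (m (permInv w j))   ≡⟨ cong (emptyCol ∘ m) (perm-≗⇒permInv-≗ w w′ perm≗ j) ⟩
    emptyCol (m (permInv w′ j))  ≡⟨ emptyCol-act w′ m j ⟨
    emptyCol (act w′ m j)        ∎
    where open ≡-Reasoning

mainTheorem11 :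
    ((i : ℕ) (m : Seq) → IsBW m → IsBW (sAct i m)) ×
    ((w w′ : List ℕ) → ((k : ℕ) → perm w k ≡ perm w′ k) →
      (m : Seq) → IsBW m → (j : ℕ) → act w m j ≡ act w′ m j)
mainTheorem11 = IsBW-sAct , act-perm-invariant
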